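{- Let $G=(V,E)$ be a finite connected directed graph with no loops and such that for distinct vertices $a,b$ at most one of $(a,b),(b,a)$ lies in $E$. Let $f$ be a real function on $V$ and $A$ a real function on $E$ with $\nabla\cdot A=f$. Let $T\subseteq E$ form a spanning tree of the underlying undirected graph, $s$ a leaf of $T$, $u$ the function on $V$ induced from $A$ by $T$ and $s$, and $T'=E\setminus T$. Then $$\mathrm{gap}(A)=(A-\nabla u,A-\nabla u)_{T'}.$$
   Context: For real functions on a finite set $D$, $(f,g)_D=\sum_{x\in D}f(x)g(x)$ (subscript dropped for the full domain) and $\|f\|^2=(f,f)$. The gradient is $\nabla u(a,b)=u(b)-u(a)$; the divergence is $\nabla\cdot A(a)=\sum_{(b,a)\in E}A(b,a)-\sum_{(a,b)\in E}A(a,b)$. The function $u$ induced from $A$ by $T$ and $s$ is defined by $u(s)=0$ and, for each vertex $t$, $u(t)$ is the sum of $A$ over the edges of the path in $T$ from $s$ to $t$, each edge counted with a plus sign if it is directed toward $t$ along the path and a minus sign otherwise. With this $u$, $\mathrm{gap}(A)=\|A\|^2-\bigl(2(u,f)-(\nabla u,\nabla u)\bigr)$. -}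

module Defs where

open import Level using (Level)
open import Data.Nat using (ℕ)
open import Data.Bool using (Bool; true; false; if_then_else_; _∧_; _∨_; not)
open import Data.Fin using (Fin)
open import Data.Fin.Properties using (_≟_)
open import Data.List using (List; []; _∷_; length; filter)
open import Data.List.Relation.Unary.Unique.Propositional using (Unique)
open import Data.Product using (_×_; _,_)
open import Data.Empty using (⊥)
open import Relation.Nullary using (¬_)
open import Relation.Nullary.Decidable using (⌊_⌋)
open import Relation.Binary.PropositionalEquality using (_≡_; _≢_)
open import Algebra.Bundles using (CommutativeRing)
import Algebra.Definitions.RawMonoid as RM

record Digraph (n m : ℕ) : Set where
  field
    src : Fin m → Fin n
    tgt : Fin m → Fin n

open Digraph public

NoLoops : ∀ {n m} → Digraph n m → Set
NoLoops G = ∀ e → src G e ≢ tgt G e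

-- E is a set of ordered pairs (distinct indices give distinct pairs), and for
-- distinct a,b at most one of (a,b),(b,a) is an edge.
Simple : ∀ {n m} → Digraph n m → Set
Simple G = ∀ e e' →
  (src G e ≡ src G e' → tgt G e ≡ tgt G e' → e ≡ e') ×
  ¬ (src G e ≡ tgt G e' × tgt G e ≡ src G e')

EdgeSet : ℕ → Set
EdgeSet m = Fin m → Bool

allEdges : ∀ {m} → EdgeSet m
allEdges _ = true

-- Walks in the underlying undirected graph of (V, S), S ⊆ E: each step
-- traverses an edge of S either forwards (src → tgt) or backwards.
data Walk {n m} (G : Digraph n m) (S : EdgeSet m) : Fin n → Fin n → Set where
  nil : ∀ {x} → Walk G S x x
  fwd : ∀ {x y} (e : Fin m) → S e ≡ true → src G e ≡ x →
        Walk G S (tgt G e) y → Walk G S x y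
  bwd : ∀ {x y} (e : Fin m) → S e ≡ true → tgt G e ≡ x →
        Walk G S (src G e) y → Walk G S x y

walkEdges : ∀ {n m} {G : Digraph n m} {S x y} → Walk G S x y → List (Fin m)
walkEdges nil = []
walkEdges (fwd e _ _ w) = e ∷ walkEdges w
walkEdges (bwd e _ _ w) = e ∷ walkEdges w

walkVertices : ∀ {n m} {G : Digraph n m} {S x y} → Walk G S x y → List (Fin n)
walkVertices {x = x} nil = x ∷ []
walkVertices {x = x} (fwd e _ _ w) = x ∷ walkVertices w
walkVertices {x = x} (bwd e _ _ w) = x ∷ walkVertices w

IsPath : ∀ {n m} {G : Digraph n m} {S x y} → Walk G S x y → Set
IsPath w = Unique (walkVertices w)

NonEmpty : ∀ {n m} {G : Digraph n m} {S x y} → Walk G S x y → Set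
NonEmpty nil = ⊥
NonEmpty (fwd _ _ _ _) = Data.Unit.⊤ where import Data.Unit
NonEmpty (bwd _ _ _ _) = Data.Unit.⊤ where import Data.Unit

Connected : ∀ {n m} → Digraph n m → EdgeSet m → Set
Connected G S = ∀ x y → Walk G S x y

Acyclic : ∀ {n m} → Digraph n m → EdgeSet m → Set
Acyclic G S = ∀ x (w : Walk G S x x) → NonEmpty w → ¬ Unique (walkEdges w)

SpanningTree : ∀ {n m} → Digraph n m → EdgeSet m → Set
SpanningTree G T = Connected G T × Acyclic G T

degree : ∀ {n m} → Digraph n m → EdgeSet m → Fin n → ℕ
degree {m = m} G T s =
  length (filter (λ e → Relation.Nullary.Decidable.Core.T? (T e ∧ (⌊ src G e ≟ s ⌋ ∨ ⌊ tgt G e ≟ s ⌋)))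
                 (Data.List.allFin m))
  where import Relation.Nullary.Decidable.Core
        import Data.List

IsLeaf : ∀ {n m} → Digraph n m → EdgeSet m → Fin n → Set
IsLeaf G T s = degree G T s ≡ 1

-- Functions valued in a commutative ring R (standing in for ℝ)

module _ {c ℓ : Level} (R : CommutativeRing c ℓ) where
  open CommutativeRing R
  open RM +-rawMonoid using (sum)

  innerOn : ∀ {k} → (Fin k → Bool) → (Fin k → Carrier) → (Fin k → Carrier) → Carrier
  innerOn D f g = sum (λ x → if D x then f x * g x else 0#)

  inner : ∀ {k} → (Fin k → Carrier) → (Fin k → Carrier) → Carrier
  inner f g = sum (λ x → f x * g x)

  grad : ∀ {n m} → Digraph n m → (Fin n → Carrier) → (Fin m → Carrier)
  grad G u e = u (tgt G e) - u (src G e)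

  div : ∀ {n m} → Digraph n m → (Fin m → Carrier) → (Fin n → Carrier)
  div G A a =
    sum (λ e → if ⌊ tgt G e ≟ a ⌋ then A e else 0#)
    - sum (λ e → if ⌊ src G e ≟ a ⌋ then A e else 0#)

  signedSum : ∀ {n m} {G : Digraph n m} {S x y} → (Fin m → Carrier) → Walk G S x y → Carrier
  signedSum A nil = 0#
  signedSum A (fwd e _ _ w) = A e + signedSum A w
  signedSum A (bwd e _ _ w) = - A e + signedSum A w

  InducedBy : ∀ {n m} → Digraph n m → (Fin m → Carrier) → EdgeSet m → Fin n →
              (Fin n → Carrier) → Set ℓ
  InducedBy G A T s u =
    (u s ≈ 0#) × (∀ t (p : Walk G T s t) → IsPath p → u t ≈ signedSum A p)

  gap : ∀ {n m} → Digraph n m → (Fin n → Carrier) → (Fin m → Carrier) →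
        (Fin n → Carrier) → Carrier
  gap G f A u = inner A A - ((inner u f + inner u f) - inner (grad G u) (grad G u))

-- Summation by parts turns (u, f) = (u, ∇·A) into (∇u, A), so for every u
-- the gap is a completed square: gap(A) = ‖A - ∇u‖².  For the induced u the
-- residual A - ∇u vanishes on T: if e ∈ T runs from a to b, the tree path
-- from s to b either extends the tree path from s to a by e, or passes
-- through b on its way to a, in which case acyclicity forces the remaining
-- piece b → a to be e traversed backwards.  In both cases u(b) = u(a) + A(e).
module Submission where

open import Defs
open import Level using (Level)
open import Data.Nat using (ℕ; zero; suc)
open import Data.Bool using (Bool; true; false; not; if_then_else_)
open import Data.Bool.Properties using (not-injective)
open import Data.Fin using (Fin; zero; suc)
open import Data.Fin.Properties using (_≟_)
open import Data.List using (List; _∷_)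
open import Data.List.Membership.Propositional using (_∈_; _∉_)
import Data.List.Membership.DecPropositional as DecMembership
open import Data.List.Relation.Unary.Any using (here; there)
open import Data.List.Relation.Unary.All.Properties using (¬Any⇒All¬)
open import Data.List.Relation.Unary.AllPairs using ([]; _∷_)
open import Data.List.Relation.Unary.Unique.Propositional using (Unique)
open import Data.List.Relation.Unary.Unique.Propositional.Properties
  using (Unique[x∷xs]⇒x∉xs)
open import Data.Product using (Σ; _×_; _,_; proj₁; proj₂)
open import Data.Sum using (_⊎_; inj₁; inj₂; [_,_])
open import Data.Empty using (⊥; ⊥-elim)
open import Data.Unit using (tt)
open import Function using (_∘_)
open import Relation.Nullary using (yes; no)
open import Relation.Nullary.Decidable using (⌊_⌋; ⌊⌋-map′)
open import Relation.Binary.PropositionalEquality as ≡ using (_≡_; _≢_)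
open import Algebra.Bundles using (CommutativeRing; Ring)

fresh-∷ : ∀ {a} {X : Set a} {x : X} {xs : List X} → x ∉ xs → Unique xs → Unique (x ∷ xs)
fresh-∷ {xs = xs} x∉xs xs-unique = ¬Any⇒All¬ xs x∉xs ∷ xs-unique

module WalkProperties {n m : ℕ} {G : Digraph n m} {S : EdgeSet m} where

  start∈walkVertices : ∀ {x y} (w : Walk G S x y) → x ∈ walkVertices w
  start∈walkVertices nil           = here ≡.refl
  start∈walkVertices (fwd _ _ _ _) = here ≡.refl
  start∈walkVertices (bwd _ _ _ _) = here ≡.refl

  end∈walkVertices : ∀ {x y} (w : Walk G S x y) → y ∈ walkVertices w
  end∈walkVertices nil           = here ≡.refl
  end∈walkVertices (fwd _ _ _ w) = there (end∈walkVertices w)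
  end∈walkVertices (bwd _ _ _ w) = there (end∈walkVertices w)

  endpoints∈walkVertices : ∀ {x y} (w : Walk G S x y) {e} → e ∈ walkEdges w →
                           src G e ∈ walkVertices w × tgt G e ∈ walkVertices w
  endpoints∈walkVertices (fwd _ _ h w) (here ≡.refl) = here h , there (start∈walkVertices w)
  endpoints∈walkVertices (bwd _ _ h w) (here ≡.refl) = there (start∈walkVertices w) , here h
  endpoints∈walkVertices (fwd _ _ _ w) (there e∈w) =
    let (src∈ , tgt∈) = endpoints∈walkVertices w e∈w in there src∈ , there tgt∈
  endpoints∈walkVertices (bwd _ _ _ w) (there e∈w) =
    let (src∈ , tgt∈) = endpoints∈walkVertices w e∈w in there src∈ , there tgt∈

  src∉⇒∉walkEdges : ∀ {x y} (w : Walk G S x y) {e} → src G e ∉ walkVertices w → e ∉ walkEdges w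
  src∉⇒∉walkEdges w src∉w = src∉w ∘ proj₁ ∘ endpoints∈walkVertices w

  tgt∉⇒∉walkEdges : ∀ {x y} (w : Walk G S x y) {e} → tgt G e ∉ walkVertices w → e ∉ walkEdges w
  tgt∉⇒∉walkEdges w tgt∉w = tgt∉w ∘ proj₂ ∘ endpoints∈walkVertices w

  path⇒unique-edges : ∀ {x y} (w : Walk G S x y) → IsPath w → Unique (walkEdges w)
  path⇒unique-edges nil _ = []
  path⇒unique-edges (fwd _ _ ≡.refl w) w-path@(_ ∷ w′-path) =
    fresh-∷ (src∉⇒∉walkEdges w (Unique[x∷xs]⇒x∉xs w-path)) (path⇒unique-edges w w′-path)
  path⇒unique-edges (bwd _ _ ≡.refl w) w-path@(_ ∷ w′-path) =
    fresh-∷ (tgt∉⇒∉walkEdges w (Unique[x∷xs]⇒x∉xs w-path)) (path⇒unique-edges w w′-path)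

  closed-path⇒nil : ∀ {x} (w : Walk G S x x) → IsPath w → w ≡ nil
  closed-path⇒nil nil _ = ≡.refl
  closed-path⇒nil (fwd _ _ _ w) w-path = ⊥-elim (Unique[x∷xs]⇒x∉xs w-path (end∈walkVertices w))
  closed-path⇒nil (bwd _ _ _ w) w-path = ⊥-elim (Unique[x∷xs]⇒x∉xs w-path (end∈walkVertices w))

  snoc : ∀ {x a} → Walk G S x a → ∀ e → S e ≡ true → src G e ≡ a → Walk G S x (tgt G e)
  snoc nil              e e∈S h = fwd e e∈S h nil
  snoc (fwd e′ t′ h′ w) e e∈S h = fwd e′ t′ h′ (snoc w e e∈S h)
  snoc (bwd e′ t′ h′ w) e e∈S h = bwd e′ t′ h′ (snoc w e e∈S h)

  ∈snoc⁻ : ∀ {x a} (w : Walk G S x a) e e∈S h {z} →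
           z ∈ walkVertices (snoc w e e∈S h) → z ∈ walkVertices w ⊎ z ≡ tgt G e
  ∈snoc⁻ nil           _ _ _ (here z≡x)         = inj₁ (here z≡x)
  ∈snoc⁻ nil           _ _ _ (there (here z≡b)) = inj₂ z≡b
  ∈snoc⁻ (fwd _ _ _ _) _ _ _ (here z≡x)         = inj₁ (here z≡x)
  ∈snoc⁻ (fwd _ _ _ w) e e∈S h (there z∈)       = [ inj₁ ∘ there , inj₂ ] (∈snoc⁻ w e e∈S h z∈)
  ∈snoc⁻ (bwd _ _ _ _) _ _ _ (here z≡x)         = inj₁ (here z≡x)
  ∈snoc⁻ (bwd _ _ _ w) e e∈S h (there z∈)       = [ inj₁ ∘ there , inj₂ ] (∈snoc⁻ w e e∈S h z∈)

  snoc-isPath : ∀ {x a} (w : Walk G S x a) e e∈S h → IsPath w → tgt G e ∉ walkVertices w →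
                IsPath (snoc w e e∈S h)
  snoc-isPath nil e _ _ _ b∉w =
    fresh-∷ (λ { (here x≡b) → b∉w (here (≡.sym x≡b)) ; (there ()) }) (fresh-∷ (λ ()) [])
  snoc-isPath {x} (fwd _ _ _ w) e e∈S h w-path@(_ ∷ w′-path) b∉w =
    fresh-∷ x∉snoc (snoc-isPath w e e∈S h w′-path (b∉w ∘ there))
    where
    x∉snoc : x ∉ walkVertices (snoc w e e∈S h)
    x∉snoc = [ Unique[x∷xs]⇒x∉xs w-path , (λ x≡b → b∉w (here (≡.sym x≡b))) ] ∘ ∈snoc⁻ w e e∈S h
  snoc-isPath {x} (bwd _ _ _ w) e e∈S h w-path@(_ ∷ w′-path) b∉w =
    fresh-∷ x∉snoc (snoc-isPath w e e∈S h w′-path (b∉w ∘ there))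
    where
    x∉snoc : x ∉ walkVertices (snoc w e e∈S h)
    x∉snoc = [ Unique[x∷xs]⇒x∉xs w-path , (λ x≡b → b∉w (here (≡.sym x≡b))) ] ∘ ∈snoc⁻ w e e∈S h

  acyclic⇒loopless : Acyclic G S → ∀ e → S e ≡ true → src G e ≢ tgt G e
  acyclic⇒loopless acyclic e e∈S loop =
    acyclic (tgt G e) (fwd e e∈S loop nil) tt (fresh-∷ (λ ()) [])

  no-cycle-through : Acyclic G S → ∀ e → S e ≡ true → (r : Walk G S (tgt G e) (src G e)) →
                     IsPath r → e ∉ walkEdges r → ⊥
  no-cycle-through acyclic e e∈S r r-path e∉r =
    acyclic (src G e) (fwd e e∈S ≡.refl r) tt (fresh-∷ e∉r (path⇒unique-edges r r-path))

module _ {c ℓ : Level} (R : CommutativeRing c ℓ) where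
  open CommutativeRing R hiding (zero)
  open import Algebra.Properties.Semiring.Sum semiring
    using (sum; sum-cong-≋; sum-replicate-zero; ∑-distrib-+; ∑-comm; *-distribˡ-sum)
  open import Algebra.Properties.Group +-group using (ε⁻¹≈ε; //-rightDividesˡ)
  open import Algebra.Properties.AbelianGroup +-abelianGroup using (⁻¹-∙-comm; xyx⁻¹≈y)
  open import Algebra.Properties.RingWithoutOne (Ring.ringWithoutOne ring) using (x[y-z]≈xy-xz; [y-z]x≈yx-zx)
  open import Relation.Binary.Reasoning.Setoid setoid

  ∑-neg : ∀ {k} (f : Fin k → Carrier) → sum (λ i → - f i) ≈ - sum f
  ∑-neg {zero}  f = sym ε⁻¹≈ε
  ∑-neg {suc k} f = trans (+-congˡ (∑-neg (λ i → f (suc i)))) (⁻¹-∙-comm (f zero) _)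

  ∑-distrib-− : ∀ {k} (f g : Fin k → Carrier) → sum (λ i → f i - g i) ≈ sum f - sum g
  ∑-distrib-− f g = trans (∑-distrib-+ f (λ i → - g i)) (+-congˡ (∑-neg g))

  ∑-δ : ∀ {k} (i : Fin k) (g : Fin k → Carrier) → sum (λ j → if ⌊ i ≟ j ⌋ then g j else 0#) ≈ g i
  ∑-δ {suc k} zero    g = trans (+-congˡ (sum-replicate-zero k)) (+-identityʳ (g zero))
  ∑-δ {suc k} (suc i) g = begin
    0# + sum (λ j → if ⌊ suc i ≟ suc j ⌋ then g (suc j) else 0#) ≈⟨ +-identityˡ _ ⟩
    sum (λ j → if ⌊ suc i ≟ suc j ⌋ then g (suc j) else 0#)
      ≈⟨ sum-cong-≋ (λ j → reflexive (≡.cong (λ b → if b then g (suc j) else 0#) (⌊⌋-map′ _ _ (i ≟ j)))) ⟩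
    sum (λ j → if ⌊ i ≟ j ⌋ then g (suc j) else 0#)                ≈⟨ ∑-δ i (λ j → g (suc j)) ⟩
    g (suc i)                                                     ∎

  *-if : ∀ b x y → x * (if b then y else 0#) ≈ (if b then x * y else 0#)
  *-if true  x y = refl
  *-if false x y = zeroʳ x

  ∑-incident : ∀ {n m} (end : Fin m → Fin n) (u : Fin n → Carrier) (A : Fin m → Carrier) →
               sum (λ a → u a * sum (λ e → if ⌊ end e ≟ a ⌋ then A e else 0#))
               ≈ sum (λ e → u (end e) * A e)
  ∑-incident end u A = begin
    sum (λ a → u a * sum (λ e → δA a e))            ≈⟨ sum-cong-≋ (λ a → *-distribˡ-sum (u a) (δA a)) ⟩
    sum (λ a → sum (λ e → u a * δA a e))            ≈⟨ sum-cong-≋ (λ a → sum-cong-≋ (λ e → *-if (δ a e) (u a) (A e))) ⟩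
    sum (λ a → sum (λ e → if δ a e then u a * A e else 0#)) ≈⟨ ∑-comm (λ a e → if δ a e then u a * A e else 0#) ⟩
    sum (λ e → sum (λ a → if δ a e then u a * A e else 0#)) ≈⟨ sum-cong-≋ (λ e → ∑-δ (end e) (λ a → u a * A e)) ⟩
    sum (λ e → u (end e) * A e)                     ∎
    where
    δ : Fin _ → Fin _ → Bool
    δ a e = ⌊ end e ≟ a ⌋
    δA : Fin _ → Fin _ → Carrier
    δA a e = if δ a e then A e else 0#

  inner-div≈inner-grad : ∀ {n m} (G : Digraph n m) (u : Fin n → Carrier) (A : Fin m → Carrier) →
                         inner R u (div R G A) ≈ inner R (grad R G u) A
  inner-div≈inner-grad G u A = begin
    sum (λ a → u a * (into a - outof a))
      ≈⟨ sum-cong-≋ (λ a → x[y-z]≈xy-xz (u a) (into a) (outof a)) ⟩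
    sum (λ a → u a * into a - u a * outof a)
      ≈⟨ ∑-distrib-− (λ a → u a * into a) (λ a → u a * outof a) ⟩
    sum (λ a → u a * into a) - sum (λ a → u a * outof a)
      ≈⟨ +-cong (∑-incident (tgt G) u A) (-‿cong (∑-incident (src G) u A)) ⟩
    sum (λ e → u (tgt G e) * A e) - sum (λ e → u (src G e) * A e)
      ≈⟨ ∑-distrib-− (λ e → u (tgt G e) * A e) (λ e → u (src G e) * A e) ⟨
    sum (λ e → u (tgt G e) * A e - u (src G e) * A e)
      ≈⟨ sum-cong-≋ (λ e → [y-z]x≈yx-zx (A e) (u (tgt G e)) (u (src G e))) ⟨
    sum (λ e → grad R G u e * A e) ∎
    where
    into outof : Fin _ → Carrier
    into  a = sum (λ e → if ⌊ tgt G e ≟ a ⌋ then A e else 0#)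
    outof a = sum (λ e → if ⌊ src G e ≟ a ⌋ then A e else 0#)

  [x-y]²≈x²-[2yx-y²] : ∀ x y → (x - y) * (x - y) ≈ x * x - ((y * x + y * x) - y * y)
  [x-y]²≈x²-[2yx-y²] x y = begin
    (x - y) * (x - y)                 ≈⟨ x[y-z]≈xy-xz (x - y) x y ⟩
    (x - y) * x - (x - y) * y         ≈⟨ +-cong ([y-z]x≈yx-zx x x y) (-‿cong ([y-z]x≈yx-zx y x y)) ⟩
    (x * x - y * x) - (x * y - y * y) ≈⟨ +-congˡ (-‿cong (+-congʳ (*-comm x y))) ⟩
    (x * x - y * x) - (y * x - y * y) ≈⟨ +-assoc (x * x) (- (y * x)) _ ⟩
    x * x + (- (y * x) - (y * x - y * y)) ≈⟨ +-congˡ (⁻¹-∙-comm (y * x) _) ⟩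
    x * x - (y * x + (y * x - y * y))  ≈⟨ +-congˡ (-‿cong (+-assoc (y * x) (y * x) _)) ⟨
    x * x - ((y * x + y * x) - y * y) ∎

  gap≈‖A-∇u‖² : ∀ {n m} (G : Digraph n m) (f : Fin n → Carrier) (A : Fin m → Carrier) →
                (∀ a → div R G A a ≈ f a) → (u : Fin n → Carrier) →
                gap R G f A u ≈ inner R (λ e → A e - grad R G u e) (λ e → A e - grad R G u e)
  gap≈‖A-∇u‖² G f A div≈f u = begin
    sum A² - ((inner R u f + inner R u f) - sum ∇u²)   ≈⟨ +-congˡ (-‿cong (+-congʳ (+-cong uf≈∇uA uf≈∇uA))) ⟩
    sum A² - ((sum ∇uA + sum ∇uA) - sum ∇u²)           ≈⟨ +-congˡ (-‿cong (+-congʳ (∑-distrib-+ ∇uA ∇uA))) ⟨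
    sum A² - (sum (λ e → ∇uA e + ∇uA e) - sum ∇u²)     ≈⟨ +-congˡ (-‿cong (∑-distrib-− (λ e → ∇uA e + ∇uA e) ∇u²)) ⟨
    sum A² - sum (λ e → (∇uA e + ∇uA e) - ∇u² e)       ≈⟨ ∑-distrib-− A² (λ e → (∇uA e + ∇uA e) - ∇u² e) ⟨
    sum (λ e → A² e - ((∇uA e + ∇uA e) - ∇u² e))       ≈⟨ sum-cong-≋ (λ e → [x-y]²≈x²-[2yx-y²] (A e) (∇u e)) ⟨
    sum (λ e → (A e - ∇u e) * (A e - ∇u e))            ∎
    where
    ∇u ∇uA A² ∇u² : Fin _ → Carrier
    ∇u    = grad R G u
    ∇uA e = ∇u e * A e
    A²  e = A e * A e
    ∇u² e = ∇u e * ∇u e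
    uf≈∇uA : inner R u f ≈ sum ∇uA
    uf≈∇uA = trans (sum-cong-≋ (λ a → *-congˡ (sym (div≈f a)))) (inner-div≈inner-grad G u A)

  inner≈innerOn : ∀ {k} (D : Fin k → Bool) (f g : Fin k → Carrier) →
                  (∀ x → D x ≡ false → f x ≈ 0#) → inner R f g ≈ innerOn R D f g
  inner≈innerOn D f g vanish = sum-cong-≋ (λ x → masked (D x) (vanish x))
    where
    masked : ∀ b {y z} → (b ≡ false → y ≈ 0#) → y * z ≈ (if b then y * z else 0#)
    masked true  _    = refl
    masked false y≈0 = trans (*-congʳ (y≈0 ≡.refl)) (zeroˡ _)

  module _ {n m : ℕ} {G : Digraph n m} {S : EdgeSet m} (A : Fin m → Carrier) where
    open WalkProperties {G = G} {S = S}
    open DecMembership {A = Fin n} _≟_ using (_∈?_)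

    record Split {x y} (p : Walk G S x y) (b : Fin n) : Set ℓ where
      field
        prefix          : Walk G S x b
        suffix          : Walk G S b y
        prefix⊆         : ∀ {z} → z ∈ walkVertices prefix → z ∈ walkVertices p
        prefix-isPath   : IsPath p → IsPath prefix
        suffix-isPath   : IsPath p → IsPath suffix
        signedSum-split : signedSum R A p ≈ signedSum R A prefix + signedSum R A suffix

    open Split

    splitAtStart : ∀ {x y} (p : Walk G S x y) → Split p x
    splitAtStart p = record
      { prefix          = nil
      ; suffix          = p
      ; prefix⊆         = λ { (here ≡.refl) → start∈walkVertices p ; (there ()) }
      ; prefix-isPath   = λ _ → fresh-∷ (λ ()) []
      ; suffix-isPath   = λ p-path → p-path
      ; signedSum-split = sym (+-identityˡ _)
      }

    split : ∀ {x y b} (p : Walk G S x y) → b ∈ walkVertices p → Split p b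
    split p@nil           (here ≡.refl) = splitAtStart p
    split p@(fwd _ _ _ _) (here ≡.refl) = splitAtStart p
    split p@(bwd _ _ _ _) (here ≡.refl) = splitAtStart p
    split (fwd e e∈S h p) (there b∈p) = record
      { prefix          = fwd e e∈S h (prefix P)
      ; suffix          = suffix P
      ; prefix⊆         = λ { (here z≡x) → here z≡x ; (there z∈) → there (prefix⊆ P z∈) }
      ; prefix-isPath   = λ { p-path@(_ ∷ p′-path) →
                              fresh-∷ (Unique[x∷xs]⇒x∉xs p-path ∘ prefix⊆ P) (prefix-isPath P p′-path) }
      ; suffix-isPath   = λ { (_ ∷ p′-path) → suffix-isPath P p′-path }
      ; signedSum-split = trans (+-congˡ (signedSum-split P)) (sym (+-assoc _ _ _))
      }
      where P = split p b∈p
    split (bwd e e∈S h p) (there b∈p) = record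
      { prefix          = bwd e e∈S h (prefix P)
      ; suffix          = suffix P
      ; prefix⊆         = λ { (here z≡x) → here z≡x ; (there z∈) → there (prefix⊆ P z∈) }
      ; prefix-isPath   = λ { p-path@(_ ∷ p′-path) →
                              fresh-∷ (Unique[x∷xs]⇒x∉xs p-path ∘ prefix⊆ P) (prefix-isPath P p′-path) }
      ; suffix-isPath   = λ { (_ ∷ p′-path) → suffix-isPath P p′-path }
      ; signedSum-split = trans (+-congˡ (signedSum-split P)) (sym (+-assoc _ _ _))
      }
      where P = split p b∈p

    walk⇒path : ∀ {x y} → Walk G S x y → Σ (Walk G S x y) IsPath
    walk⇒path nil = nil , fresh-∷ (λ ()) []
    walk⇒path {x} (fwd e e∈S h w) with walk⇒path w
    ... | p , p-path with x ∈? walkVertices p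
    ...   | yes x∈p = suffix P , suffix-isPath P p-path where P = split p x∈p
    ...   | no  x∉p = fwd e e∈S h p , fresh-∷ x∉p p-path
    walk⇒path {x} (bwd e e∈S h w) with walk⇒path w
    ... | p , p-path with x ∈? walkVertices p
    ...   | yes x∈p = suffix P , suffix-isPath P p-path where P = split p x∈p
    ...   | no  x∉p = bwd e e∈S h p , fresh-∷ x∉p p-path

    signedSum-snoc : ∀ {x a} (w : Walk G S x a) e e∈S h →
                     signedSum R A (snoc w e e∈S h) ≈ signedSum R A w + A e
    signedSum-snoc nil           _ _ _ = trans (+-identityʳ _) (sym (+-identityˡ _))
    signedSum-snoc (fwd _ _ _ w) e e∈S h = trans (+-congˡ (signedSum-snoc w e e∈S h)) (sym (+-assoc _ _ _))
    signedSum-snoc (bwd _ _ _ w) e e∈S h = trans (+-congˡ (signedSum-snoc w e e∈S h)) (sym (+-assoc _ _ _))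

    -- Any path b → a other than the backward step along e would close a cycle with e.
    signedSum-across : Acyclic G S → ∀ {a b} e → S e ≡ true → src G e ≡ a → tgt G e ≡ b →
                       (r : Walk G S b a) → IsPath r → signedSum R A r ≈ - A e
    signedSum-across acyclic e e∈S a≡ b≡ nil _ =
      ⊥-elim (acyclic⇒loopless acyclic e e∈S (≡.trans a≡ (≡.sym b≡)))
    signedSum-across acyclic e e∈S ≡.refl ≡.refl r@(fwd e′ _ h′ r′) r-path =
      ⊥-elim (no-cycle-through acyclic e e∈S r r-path λ
        { (here e≡e′)  → acyclic⇒loopless acyclic e e∈S (≡.trans (≡.cong (src G) e≡e′) h′)
        ; (there e∈r′) → tgt∉⇒∉walkEdges r′ (Unique[x∷xs]⇒x∉xs r-path) e∈r′ })
    signedSum-across acyclic e e∈S ≡.refl ≡.refl r@(bwd e′ _ _ r′) r-path@(_ ∷ r′-path) with e′ ≟ e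
    ... | yes ≡.refl =
      trans (+-congˡ (reflexive (≡.cong (signedSum R A) (closed-path⇒nil r′ r′-path)))) (+-identityʳ _)
    ... | no e′≢e =
      ⊥-elim (no-cycle-through acyclic e e∈S r r-path λ
        { (here e≡e′)  → e′≢e (≡.sym e≡e′)
        ; (there e∈r′) → tgt∉⇒∉walkEdges r′ (Unique[x∷xs]⇒x∉xs r-path) e∈r′ })

    induced-grad≈ : SpanningTree G S → ∀ {s u} → InducedBy R G A S s u →
                    ∀ e → S e ≡ true → grad R G u e ≈ A e
    induced-grad≈ (connected , acyclic) {s} {u} (_ , u≈signedSum) e e∈S =
      trans (+-congʳ u-tgt) (xyx⁻¹≈y (u (src G e)) (A e))
      where
      u-tgt : u (tgt G e) ≈ u (src G e) + A e
      u-tgt with walk⇒path (connected s (src G e))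
      ... | p , p-path with tgt G e ∈? walkVertices p
      ...   | no b∉p = begin
        u (tgt G e)                        ≈⟨ u≈signedSum _ (snoc p e e∈S ≡.refl) (snoc-isPath p e e∈S ≡.refl p-path b∉p) ⟩
        signedSum R A (snoc p e e∈S ≡.refl) ≈⟨ signedSum-snoc p e e∈S ≡.refl ⟩
        signedSum R A p + A e              ≈⟨ +-congʳ (u≈signedSum _ p p-path) ⟨
        u (src G e) + A e                  ∎
      ...   | yes b∈p = begin
        u (tgt G e)                        ≈⟨ u≈signedSum _ (prefix P) (prefix-isPath P p-path) ⟩
        signedSum R A (prefix P)           ≈⟨ //-rightDividesˡ (A e) _ ⟨
        (signedSum R A (prefix P) - A e) + A e
          ≈⟨ +-congʳ (+-congˡ (signedSum-across acyclic e e∈S ≡.refl ≡.refl (suffix P) (suffix-isPath P p-path))) ⟨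
        (signedSum R A (prefix P) + signedSum R A (suffix P)) + A e ≈⟨ +-congʳ (signedSum-split P) ⟨
        signedSum R A p + A e              ≈⟨ +-congʳ (u≈signedSum _ p p-path) ⟨
        u (src G e) + A e                  ∎
        where P = split p b∈p

lemma6 : ∀ {c ℓ : Level} (R : CommutativeRing c ℓ) {n m : ℕ} (G : Digraph n m) →
         NoLoops G → Simple G → Connected G allEdges →
         (f : Fin n → CommutativeRing.Carrier R) (A : Fin m → CommutativeRing.Carrier R) →
         (∀ a → CommutativeRing._≈_ R (div R G A a) (f a)) →
         (T : EdgeSet m) → SpanningTree G T →
         (s : Fin n) → IsLeaf G T s →
         (u : Fin n → CommutativeRing.Carrier R) → InducedBy R G A T s u →
         CommutativeRing._≈_ R (gap R G f A u)
           (innerOn R (λ e → not (T e))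
             (λ e → CommutativeRing._-_ R (A e) (grad R G u e))
             (λ e → CommutativeRing._-_ R (A e) (grad R G u e)))
lemma6 R {m = m} G _ _ _ f A div≈f T tree s _ u induced =
  trans (gap≈‖A-∇u‖² R G f A div≈f u)
        (inner≈innerOn R (λ e → not (T e)) residual residual residual-on-tree)
  where
  open CommutativeRing R using (Carrier; _≈_; _-_; 0#; trans; sym)
  open import Algebra.Properties.Group (CommutativeRing.+-group R) using (x≈y⇒x∙y⁻¹≈ε)

  residual : Fin m → Carrier
  residual e = A e - grad R G u e

  residual-on-tree : ∀ e → not (T e) ≡ false → residual e ≈ 0#
  residual-on-tree e e∈T = x≈y⇒x∙y⁻¹≈ε (sym (induced-grad≈ R A tree induced e (not-injective e∈T)))
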